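{- Let $dWHA$ be the connected graded Hopf algebra of substitutions described in the context, and let $WHA\subseteq dWHA$ be the subgroup spanned by all substitutions $\binom{\rho}{\sigma}$ whose top word has the form $\rho=[\underbrace{y_1,\dots,y_1}_{r_1},\underbrace{y_2,\dots,y_2}_{r_2},\dots,\underbrace{y_m,\dots,y_m}_{r_m}]$ with $y_1,\dots,y_m$ distinct letters and $r_i\ge1$ (i.e. equal letters of $\rho$ occur only in one consecutive block). Then $WHA$ is a (graded) sub Hopf algebra of $dWHA$, closed under the multiplication and the comultiplication.
   Context: Fix an alphabet $\mathcal{X}=\{x_1,x_2,\dots\}$. A substitution is a pair of words $\binom{\rho}{\sigma}$ over $\mathcal{X}$ with equal supports (support = set of distinct letters occurring), up to simultaneous renaming of letters by a bijection; $dWHA$ is the free Abelian group on substitutions (including the empty substitution), graded by $\deg\binom{\rho}{\sigma}=\#\mathrm{supp}(\rho)$. The shuffle product $\times_{sh}$ of two words is the sum with multiplicities of all interleavings preserving the relative order of the letters of each word. Product: writing two substitutions with disjoint supports, $\binom{\rho}{\sigma}\cdot\binom{\rho'}{\sigma'}=\sum_\gamma\binom{\rho\rho'}{\gamma}$ over terms $\gamma$ of $\sigma\times_{sh}\sigma'$ ($\rho\rho'$ the concatenation). A cut $\sigma=\sigma_1\sigma_2$ (concatenation, trivial cuts allowed) is good if $\mathrm{supp}(\sigma_1)\cap\mathrm{supp}(\sigma_2)=\emptyset$; for $p=\binom{\rho}{\sigma}$, $p^{ -1}(\sigma_1)$ is the subword of $\rho$ consisting of all letters of $\rho$ lying in $\mathrm{supp}(\sigma_1)$.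 Coproduct: $\mu\binom{\rho}{\sigma}=\sum\binom{p^{ -1}(\sigma_1)}{\sigma_1}\otimes\binom{p^{ -1}(\sigma_2)}{\sigma_2}$ over all good cuts $\sigma=\sigma_1\sigma_2$. Unit is the empty substitution; counit is $1$ on it and $0$ on all other substitutions; $dWHA$ is a connected graded Hopf algebra with these structures. -}

module Defs where

open import Data.Nat using (ℕ; _≤_)
open import Data.Nat.Properties using (_≟_)
open import Data.List using (List; []; _∷_; _++_; map; filter; concatMap; replicate)
open import Data.List.Relation.Unary.All using (All; all?)
open import Data.List.Relation.Unary.Unique.Propositional using (Unique)
open import Data.List.Membership.Propositional using (_∈_)
open import Data.List.Membership.DecPropositional _≟_ using (_∈?_; _∉?_)
open import Data.Product using (Σ; _×_; _,_; proj₁; proj₂)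
open import Relation.Binary.PropositionalEquality using (_≡_)
open import Data.Empty using (⊥)

-- Letters of the alphabet X = {x_1, x_2, ...} are encoded as natural numbers.
Word : Set
Word = List ℕ

-- Substitutions are identified up to renaming of letters; all notions below are
-- computed on representatives (and are renaming-invariant).
Subst : Set
Subst = Word × Word

top bot : Subst → Word
top = proj₁
bot = proj₂

ValidSubst : Subst → Set
ValidSubst (ρ , σ) = (∀ {x} → x ∈ ρ → x ∈ σ) × (∀ {x} → x ∈ σ → x ∈ ρ)

emptySubst : Subst
emptySubst = [] , []

shuffle : Word → Word → List Word
shuffle [] ys = ys ∷ []
shuffle (x ∷ xs) [] = (x ∷ xs) ∷ []
shuffle (x ∷ xs) (y ∷ ys) =
  map (x ∷_) (shuffle xs (y ∷ ys)) ++ map (y ∷_) (shuffle (x ∷ xs) ys)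

-- Product of two substitutions written with disjoint supports:
-- (rho/sigma) . (rho'/sigma') = sum over gamma in sigma ×sh sigma' of (rho rho' / gamma),
-- represented as the list of its terms (with multiplicity).
mulSubst : Subst → Subst → List Subst
mulSubst (ρ , σ) (ρ' , σ') = map (λ γ → (ρ ++ ρ') , γ) (shuffle σ σ')

cuts : Word → List (Word × Word)
cuts [] = ([] , []) ∷ []
cuts (x ∷ xs) = ([] , x ∷ xs) ∷ map (λ c → (x ∷ proj₁ c) , proj₂ c) (cuts xs)

goodCuts : Word → List (Word × Word)
goodCuts σ = filter (λ c → all? (λ x → x ∉? proj₂ c) (proj₁ c)) (cuts σ)

preimage : Word → Word → Word
preimage ρ τ = filter (λ x → x ∈? τ) ρ

comulSubst : Subst → List (Subst × Subst)
comulSubst (ρ , σ) =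
  map (λ c → (preimage ρ (proj₁ c) , proj₁ c) , (preimage ρ (proj₂ c) , proj₂ c))
      (goodCuts σ)

BlockWord : Word → Set
BlockWord ρ =
  Σ (List (ℕ × ℕ)) λ blocks →
    Unique (map proj₁ blocks) ×
    All (λ b → 1 ≤ proj₂ b) blocks ×
    ρ ≡ concatMap (λ b → replicate (proj₂ b) (proj₁ b)) blocks

IsWHA : Subst → Set
IsWHA p = BlockWord (top p)

Disjoint : Word → Word → Set
Disjoint u v = ∀ {x} → x ∈ u → x ∈ v → ⊥

{-# OPTIONS --safe #-}
-- The top word of a product is the concatenation of the two top words, which have disjoint
-- letters, and the top word of every coproduct term is the subword of ρ on some set of
-- letters. Block words are closed under both operations: concatenating block lists with
-- disjoint letters gives a block list, and restricting to a set of letters keeps each block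
-- whole or deletes it. Neither argument looks at the bottom words.
module Submission where

open import Defs
open import Data.List using (List)
open import Data.List.Relation.Unary.All using (All)
open import Data.Product using (_×_; proj₁; proj₂)

open import Level using (0ℓ)
open import Data.Bool using (true; false)
open import Data.Empty using (⊥)
open import Data.Nat using (ℕ; suc; _≤_)
open import Data.Product using (_,_)
open import Data.List using ([]; _∷_; _++_; map; filter; concatMap; replicate)
open import Data.List.Properties using (map-++; concatMap-++; filter-++; filter-all; filter-none)
open import Data.List.Relation.Unary.All using ([]; _∷_; universal)
open import Data.List.Relation.Unary.All.Properties as All using (replicate⁺)
open import Data.List.Relation.Unary.Any using (here; there)
open import Data.List.Relation.Unary.AllPairs using ([])
open import Data.List.Relation.Unary.Unique.Propositional using (Unique)
import Data.List.Relation.Unary.Unique.Propositional.Properties as Unique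
open import Data.List.Membership.Propositional using (_∈_)
open import Data.List.Membership.Propositional.Properties using (∈-++⁺ʳ)
open import Function using (_∘_)
open import Relation.Binary.PropositionalEquality
  using (_≡_; refl; sym; cong; cong₂; subst; module ≡-Reasoning)
open import Relation.Nullary using (does; yes; no; ¬_)
open import Relation.Unary using (Pred; Decidable)

block : ℕ × ℕ → Word
block b = replicate (proj₂ b) (proj₁ b)

blocksWord : List (ℕ × ℕ) → Word
blocksWord = concatMap block

NonEmptyBlocks : List (ℕ × ℕ) → Set
NonEmptyBlocks = All (λ b → 1 ≤ proj₂ b)

BlockWord-[] : BlockWord []
BlockWord-[] = [] , [] , [] , refl

∈-blocksWord : ∀ {y} bs → NonEmptyBlocks bs → y ∈ map proj₁ bs → y ∈ blocksWord bs
∈-blocksWord ((y , suc r) ∷ bs) _              (here refl) = here refl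
∈-blocksWord ((y , r)     ∷ bs) (_ ∷ nonEmpty) (there y∈)  =
  ∈-++⁺ʳ (replicate r y) (∈-blocksWord bs nonEmpty y∈)

BlockWord-++ : ∀ {ρ ρ'} → Disjoint ρ ρ' → BlockWord ρ → BlockWord ρ' → BlockWord (ρ ++ ρ')
BlockWord-++ ρ#ρ' (bs , unique , nonEmpty , refl) (bs' , unique' , nonEmpty' , refl) =
  bs ++ bs' ,
  subst Unique (sym (map-++ proj₁ bs bs')) (Unique.++⁺ unique unique' letters#) ,
  All.++⁺ nonEmpty nonEmpty' ,
  sym (concatMap-++ block bs bs')
  where
  letters# : ∀ {y} → y ∈ map proj₁ bs × y ∈ map proj₁ bs' → ⊥
  letters# (y∈ , y∈') = ρ#ρ' (∈-blocksWord bs nonEmpty y∈) (∈-blocksWord bs' nonEmpty' y∈')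

module _ {P : Pred ℕ 0ℓ} (P? : Decidable P) where

  filter-block-accept : ∀ {b} → P (proj₁ b) → filter P? (block b) ≡ block b
  filter-block-accept {y , r} py = filter-all P? (replicate⁺ r py)

  filter-block-reject : ∀ {b} → ¬ P (proj₁ b) → filter P? (block b) ≡ []
  filter-block-reject {y , r} ¬py = filter-none P? (replicate⁺ r ¬py)

  filter-blocksWord : ∀ bs → filter P? (blocksWord bs) ≡ blocksWord (filter (P? ∘ proj₁) bs)
  filter-blocksWord []       = refl
  filter-blocksWord (b ∷ bs) with P? (proj₁ b)
  ... | yes py = begin
    filter P? (block b ++ blocksWord bs)             ≡⟨ filter-++ P? (block b) (blocksWord bs) ⟩
    filter P? (block b) ++ filter P? (blocksWord bs) ≡⟨ cong₂ _++_ (filter-block-accept {b} py) (filter-blocksWord bs) ⟩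
    block b ++ blocksWord (filter (P? ∘ proj₁) bs)   ∎
    where open ≡-Reasoning
  ... | no ¬py = begin
    filter P? (block b ++ blocksWord bs)             ≡⟨ filter-++ P? (block b) (blocksWord bs) ⟩
    filter P? (block b) ++ filter P? (blocksWord bs) ≡⟨ cong₂ _++_ (filter-block-reject {b} ¬py) (filter-blocksWord bs) ⟩
    blocksWord (filter (P? ∘ proj₁) bs)              ∎
    where open ≡-Reasoning

  map-filter-∘ : ∀ {A : Set} (f : A → ℕ) xs → map f (filter (P? ∘ f) xs) ≡ filter P? (map f xs)
  map-filter-∘ f []       = refl
  map-filter-∘ f (x ∷ xs) with does (P? (f x))
  ... | true  = cong (f x ∷_) (map-filter-∘ f xs)
  ... | false = map-filter-∘ f xs

  BlockWord-filter : ∀ {ρ} → BlockWord ρ → BlockWord (filter P? ρ)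
  BlockWord-filter (bs , unique , nonEmpty , refl) =
    filter (P? ∘ proj₁) bs ,
    subst Unique (sym (map-filter-∘ proj₁ bs)) (Unique.filter⁺ P? unique) ,
    All.filter⁺ (P? ∘ proj₁) nonEmpty ,
    filter-blocksWord bs

mainTheorem4 : IsWHA emptySubst
    × (∀ (p q : Subst) → ValidSubst p → ValidSubst q →
    Disjoint (top p) (top q) →
    IsWHA p → IsWHA q → All IsWHA (mulSubst p q))
    × (∀ (p : Subst) → ValidSubst p → IsWHA p →
    All (λ t → IsWHA (proj₁ t) × IsWHA (proj₂ t)) (comulSubst p))
mainTheorem4 = BlockWord-[] , product-closed , coproduct-closed
  where
  product-closed : ∀ (p q : Subst) → ValidSubst p → ValidSubst q →
    Disjoint (top p) (top q) → IsWHA p → IsWHA q → All IsWHA (mulSubst p q)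
  product-closed (ρ , σ) (ρ' , σ') _ _ ρ#ρ' ρ-block ρ'-block =
    All.map⁺ (universal (λ _ → BlockWord-++ ρ#ρ' ρ-block ρ'-block) (shuffle σ σ'))

  coproduct-closed : ∀ (p : Subst) → ValidSubst p → IsWHA p →
    All (λ t → IsWHA (proj₁ t) × IsWHA (proj₂ t)) (comulSubst p)
  coproduct-closed (ρ , σ) _ ρ-block =
    All.map⁺ (universal (λ _ → BlockWord-filter _ ρ-block , BlockWord-filter _ ρ-block) (goodCuts σ))
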